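{- For natural numbers $t,l,n$ with $2t<n$, one has $\beth(t,l^2,n)\ge \beth(2t,l,n)$.
   Context: Let $\mathfrak A=\{a_1<\dots<a_l\}$ be a linearly ordered $l$-letter alphabet, with lexicographic order on words ($u\succ v$ iff $u=wau'$, $v=wbv'$ with letters $a\succ b$). A word is acyclic if it is not of the form $v^j$ with $j\ge2$. A class $X(t,l)$ is a finite sequence $(C_1,\dots,C_m)$ of acyclic words of length $t$ over $\mathfrak A$ which are pairwise not cyclic shifts of one another (i.e. the corresponding word-cycles are pairwise strongly comparable: every cyclic shift of one is comparable with every cyclic shift of another). For $1\le i\le m$, $1\le j\le t$ let $w(i,j)$ be the cyclic shift of $C_i$ beginning at its $j$-th letter. On the set $\{w(i,j)\}$ define the partial order $w(i,j)\prec w(i',j')$ iff $w(i,j)$ is lexicographically smaller than $w(i',j')$ and $i<i'$. The class is $n$-light if this poset has no antichain with $n$ elements. The number of elements of the class is $m$ (the number of word-cycles), and $\beth(t,l,n)$ is the largest possible number of elements of an $n$-light class $X(t,l)$ (supremum in $\mathbb N\cup\{\infty\}$). Throughout, the first argument of $\beth$ is assumed smaller than the third. -}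

module Defs where

open import Data.Nat using (ℕ; _≤_; _<_)
open import Data.Fin using (Fin; toℕ) renaming (_<_ to _<ᶠ_)
open import Data.List using (List; []; _∷_; length; concat; replicate; drop; take; _++_)
open import Data.Product using (Σ; _×_; ∃)
open import Relation.Binary.PropositionalEquality using (_≡_; _≢_)
open import Relation.Nullary using (¬_)
open import Function.Definitions using (Injective)

-- Words over the linearly ordered alphabet 𝔄 = Fin l (a₁ < … < a_l is the order of Fin).
Word : ℕ → Set
Word l = List (Fin l)

data _≺_ {l : ℕ} : Word l → Word l → Set where
  here : ∀ {a b u v} → a <ᶠ b → (a ∷ u) ≺ (b ∷ v)
  there : ∀ {a u v} → u ≺ v → (a ∷ u) ≺ (a ∷ v)

Acyclic : ∀ {l} → Word l → Set
Acyclic {l} w = ¬ (Σ (Word l) λ v → Σ ℕ λ j → (2 ≤ j) × (w ≡ concat (replicate j v)))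

-- Cyclic shift starting at the (j+1)-th letter (j counted from 0).
rot : ∀ {l} → ℕ → Word l → Word l
rot j w = drop j w ++ take j w

-- A class X(t,l) with m elements: C : Fin m → Word l, words of length t,
-- acyclic, pairwise not cyclic shifts of one another.
IsClass : (t l m : ℕ) → (Fin m → Word l) → Set
IsClass t l m C =
  (∀ i → length (C i) ≡ t) ×
  (∀ i → Acyclic (C i)) ×
  (∀ i i' → i ≢ i' → ¬ (Σ ℕ λ j → rot j (C i) ≡ C i'))

-- w(i,j) = cyclic shift of C_i beginning at its (j+1)-th letter, j : Fin t.
w : ∀ {t l m} → (Fin m → Word l) → Fin m × Fin t → Word l
w C (i Data.Product., j) = rot (toℕ j) (C i)

Prec : ∀ {t l m} → (Fin m → Word l) → Fin m × Fin t → Fin m × Fin t → Set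
Prec {t} C p q = (w {t} C p ≺ w {t} C q) × (Data.Product.proj₁ p <ᶠ Data.Product.proj₁ q)

Antichain : (t l m n : ℕ) → (Fin m → Word l) → Set
Antichain t l m n C =
  Σ (Fin n → Fin m × Fin t) λ f → Injective _≡_ _≡_ f × (∀ a b → ¬ Prec {t} C (f a) (f b))

IsLightClass : (t l n m : ℕ) → (Fin m → Word l) → Set
IsLightClass t l n m C = IsClass t l m C × ¬ Antichain t l m n C

Achievable : (t l n m : ℕ) → Set
Achievable t l n m = Σ (Fin m → Word l) λ C → IsLightClass t l n m C

-- ℶ(t,l,n) ≥ ℶ(t',l',n') in ℕ ∪ {∞}, where ℶ is the supremum of achievable sizes:
-- every size achievable for (t',l',n') is bounded by a size achievable for (t,l,n).
BethGe : (t l n t' l' n' : ℕ) → Set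
BethGe t l n t' l' n' = ∀ m → Achievable t' l' n' m → Σ ℕ λ m' → (m ≤ m') × Achievable t l n m'

module Submission where

-- Read a word of even length
-- 2t over the alphabet Fin l as a word of length t over the alphabet of
-- pairs Fin l × Fin l ≅ Fin (l * l), the pairs being ordered
-- lexicographically (this is what 'combine' does).  This encoding
--   * is invertible on even-length words and respects concatenation, so it
--     preserves acyclicity and the property of not being cyclic shifts;
--   * turns the rotation by 2j letters into the rotation by j letters;
--   * is strictly monotone for the lexicographic order.
-- Hence, if the encoded class had an antichain of n elements (i, j), then
-- the elements (i, 2j) of the original class would form an antichain of n
-- elements as well.  So an n-light class X(2t, l) with m elements is sent to
-- an n-light class X(t, l²) with the same m elements, which gives
-- ℶ(t, l², n) ≥ ℶ(2t, l, n).

open import Defs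
open import Data.Nat using (ℕ; _*_; _<_; zero; suc; _+_; z≤n; s≤s)
import Data.Nat.Properties as NP
open import Data.Fin as F using (Fin; toℕ; combine; remQuot; fromℕ<)
import Data.Fin.Properties as FP
open import Data.List using ([]; _∷_; length; concat; replicate; drop; take; _++_)
open import Data.Product using (Σ; _×_; _,_; proj₁; proj₂)
open import Relation.Binary.PropositionalEquality
open import Relation.Nullary using (¬_)
open import Function.Definitions using (Injective)

-- Doubling by structural recursion, so that it peels off two letters at a
-- time in the same way as the encoding does.
double : ℕ → ℕ
double zero = zero
double (suc j) = suc (suc (double j))

2*≡double : ∀ t → 2 * t ≡ double t
2*≡double zero = refl
2*≡double (suc t) = cong suc (trans (NP.+-suc t (t + 0)) (cong suc (2*≡double t)))

double-injective : ∀ {a b} → double a ≡ double b → a ≡ b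
double-injective {zero} {zero} _ = refl
double-injective {suc a} {suc b} e =
  cong suc (double-injective (NP.suc-injective (NP.suc-injective e)))

double-mono-< : ∀ {a b} → a < b → double a < double b
double-mono-< {zero} {suc b} _ = s≤s z≤n
double-mono-< {suc a} {suc b} (s≤s p) = s≤s (s≤s (double-mono-< p))

doubleFin : ∀ {t} → Fin t → Fin (2 * t)
doubleFin {t} j =
  fromℕ< (subst (double (toℕ j) <_) (sym (2*≡double t)) (double-mono-< (FP.toℕ<n j)))

toℕ-doubleFin : ∀ {t} (j : Fin t) → toℕ (doubleFin j) ≡ double (toℕ j)
toℕ-doubleFin j = FP.toℕ-fromℕ< _

doubleFin-injective : ∀ {t} → Injective _≡_ _≡_ (doubleFin {t})
doubleFin-injective {x = j} {y = j'} e = FP.toℕ-injective (double-injective (begin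
  double (toℕ j)      ≡⟨ toℕ-doubleFin j ⟨
  toℕ (doubleFin j)   ≡⟨ cong toℕ e ⟩
  toℕ (doubleFin j')  ≡⟨ toℕ-doubleFin j' ⟩
  double (toℕ j')     ∎))
  where open ≡-Reasoning

module Pairing {l : ℕ} where

  data Even : Word l → Set where
    e[] : Even []
    e∷ : ∀ {a b u} → Even u → Even (a ∷ b ∷ u)

  even-length : ∀ t (u : Word l) → length u ≡ double t → Even u
  even-length zero [] _ = e[]
  even-length (suc t) (a ∷ b ∷ u) p =
    e∷ (even-length t u (NP.suc-injective (NP.suc-injective p)))
  even-length zero (_ ∷ _) ()
  even-length (suc t) [] ()
  even-length (suc t) (_ ∷ []) ()

  even-++ : ∀ {x y} → Even x → Even y → Even (x ++ y)
  even-++ e[] ey = ey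
  even-++ (e∷ ex) ey = e∷ (even-++ ex ey)

  even-drop : ∀ j {u} → Even u → Even (drop (double j) u)
  even-drop zero e = e
  even-drop (suc j) e[] = e[]
  even-drop (suc j) (e∷ e) = even-drop j e

  even-take : ∀ j {u} → Even u → Even (take (double j) u)
  even-take zero e = e[]
  even-take (suc j) e[] = e[]
  even-take (suc j) (e∷ e) = e∷ (even-take j e)

  even-rot : ∀ j {u} → Even u → Even (rot (double j) u)
  even-rot j e = even-++ (even-drop j e) (even-take j e)

  enc : Word l → Word (l * l)
  enc (a ∷ b ∷ u) = combine a b ∷ enc u
  enc _ = []

  dec : Word (l * l) → Word l
  dec [] = []
  dec (c ∷ v) = proj₁ (remQuot {l} l c) ∷ proj₂ (remQuot {l} l c) ∷ dec v

  dec-enc : ∀ {u} → Even u → dec (enc u) ≡ u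
  dec-enc e[] = refl
  dec-enc (e∷ {a} {b} e) =
    cong₂ (λ p z → proj₁ p ∷ proj₂ p ∷ z) (FP.remQuot-combine {l} {l} a b) (dec-enc e)

  enc-injective : ∀ {u u'} → Even u → Even u' → enc u ≡ enc u' → u ≡ u'
  enc-injective {u} {u'} eu eu' e = begin
    u              ≡⟨ dec-enc eu ⟨
    dec (enc u)    ≡⟨ cong dec e ⟩
    dec (enc u')   ≡⟨ dec-enc eu' ⟩
    u'             ∎
    where open ≡-Reasoning

  dec-++ : ∀ x y → dec (x ++ y) ≡ dec x ++ dec y
  dec-++ [] y = refl
  dec-++ (c ∷ x) y = cong (λ z → _ ∷ _ ∷ z) (dec-++ x y)

  dec-power : ∀ j v → dec (concat (replicate j v)) ≡ concat (replicate j (dec v))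
  dec-power zero v = refl
  dec-power (suc j) v = trans (dec-++ v _) (cong (dec v ++_) (dec-power j v))

  enc-length : ∀ t (u : Word l) → length u ≡ double t → length (enc u) ≡ t
  enc-length zero [] _ = refl
  enc-length (suc t) (a ∷ b ∷ u) p =
    cong suc (enc-length t u (NP.suc-injective (NP.suc-injective p)))
  enc-length zero (_ ∷ _) ()
  enc-length (suc t) [] ()
  enc-length (suc t) (_ ∷ []) ()

  enc-++ : ∀ {x} y → Even x → enc (x ++ y) ≡ enc x ++ enc y
  enc-++ y e[] = refl
  enc-++ y (e∷ e) = cong (_ ∷_) (enc-++ y e)

  enc-drop : ∀ j {u} → Even u → enc (drop (double j) u) ≡ drop j (enc u)
  enc-drop zero e = refl
  enc-drop (suc j) e[] = refl
  enc-drop (suc j) (e∷ e) = enc-drop j e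

  enc-take : ∀ j {u} → Even u → enc (take (double j) u) ≡ take j (enc u)
  enc-take zero e = refl
  enc-take (suc j) e[] = refl
  enc-take (suc j) (e∷ e) = cong (_ ∷_) (enc-take j e)

  enc-rot : ∀ j {u} → Even u → enc (rot (double j) u) ≡ rot j (enc u)
  enc-rot j {u} e = begin
    enc (drop (double j) u ++ take (double j) u)
      ≡⟨ enc-++ (take (double j) u) (even-drop j e) ⟩
    enc (drop (double j) u) ++ enc (take (double j) u)
      ≡⟨ cong₂ _++_ (enc-drop j e) (enc-take j e) ⟩
    drop j (enc u) ++ take j (enc u)
      ∎
    where open ≡-Reasoning

  combine-monoʳ-< : ∀ (a : Fin l) {b c : Fin l} → b F.< c → combine a b F.< combine a c
  combine-monoʳ-< a {b} {c} p rewrite FP.toℕ-combine a b | FP.toℕ-combine a c =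
    NP.+-monoʳ-< (l * toℕ a) p

  enc-mono-≺ : ∀ {x y} → Even x → Even y → x ≺ y → enc x ≺ enc y
  enc-mono-≺ (e∷ ex) (e∷ ey) (here p) = here (FP.combine-monoˡ-< _ _ p)
  enc-mono-≺ (e∷ ex) (e∷ ey) (there (here p)) = here (combine-monoʳ-< _ p)
  enc-mono-≺ (e∷ ex) (e∷ ey) (there (there p)) = there (enc-mono-≺ ex ey p)

  -- Acyclicity is preserved: a power decomposition enc u = v^j decodes to
  -- u = (dec v)^j.
  enc-acyclic : ∀ {u} → Even u → Acyclic u → Acyclic (enc u)
  enc-acyclic {u} eu acyclic (v , j , 2≤j , e) = acyclic (dec v , j , 2≤j , (begin
    u                             ≡⟨ dec-enc eu ⟨
    dec (enc u)                   ≡⟨ cong dec e ⟩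
    dec (concat (replicate j v))  ≡⟨ dec-power j v ⟩
    concat (replicate j (dec v))  ∎))
    where open ≡-Reasoning

  -- A rotation identifying two encodings lifts to a rotation (by twice as
  -- many letters) identifying the original words.
  enc-rot-reflect : ∀ {u u'} → Even u → Even u' →
                    Σ ℕ (λ j → rot j (enc u) ≡ enc u') → Σ ℕ (λ j → rot j u ≡ u')
  enc-rot-reflect eu eu' (j , e) =
    double j , enc-injective (even-rot j eu) eu' (trans (enc-rot j eu) e)

open Pairing

encClass : ∀ {l m} → (Fin m → Word l) → Fin m → Word (l * l)
encClass C i = enc (C i)

module Transfer {t l m : ℕ} (C : Fin m → Word l)
                (len : ∀ i → length (C i) ≡ 2 * t) where

  even : ∀ i → Even (C i)
  even i = even-length t (C i) (trans (len i) (2*≡double t))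

  enc-w : ∀ (p : Fin m × Fin t) →
          w {t} (encClass C) p ≡ enc (w {2 * t} C (proj₁ p , doubleFin (proj₂ p)))
  enc-w (i , j) = begin
    rot (toℕ j) (enc (C i))               ≡⟨ enc-rot (toℕ j) (even i) ⟨
    enc (rot (double (toℕ j)) (C i))      ≡⟨ cong (λ k → enc (rot k (C i))) (toℕ-doubleFin j) ⟨
    enc (rot (toℕ (doubleFin j)) (C i))   ∎
    where open ≡-Reasoning

  prec-encode : ∀ (p q : Fin m × Fin t) →
                Prec {2 * t} C (proj₁ p , doubleFin (proj₂ p)) (proj₁ q , doubleFin (proj₂ q)) →
                Prec {t} (encClass C) p q
  prec-encode p@(i , j) q@(i' , j') (lt , i<i') =
    subst₂ _≺_ (sym (enc-w p)) (sym (enc-w q)) (enc-mono-≺ (even-at j i) (even-at j' i') lt) , i<i'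
    where
    even-at : ∀ (k : Fin t) i → Even (rot (toℕ (doubleFin k)) (C i))
    even-at k i = subst (λ r → Even (rot r (C i))) (sym (toℕ-doubleFin k))
                        (even-rot (toℕ k) (even i))

  antichain-decode : ∀ {n} → Antichain t (l * l) m n (encClass C) → Antichain (2 * t) l m n C
  antichain-decode {n} (f , f-injective , incomparable) =
    g , g-injective , λ a b comparable → incomparable a b (prec-encode (f a) (f b) comparable)
    where
    g : Fin n → Fin m × Fin (2 * t)
    g a = proj₁ (f a) , doubleFin (proj₂ (f a))
    g-injective : Injective _≡_ _≡_ g
    g-injective e = f-injective (cong₂ _,_ (cong proj₁ e) (doubleFin-injective (cong proj₂ e)))

encode-lightClass : ∀ {t l n m} (C : Fin m → Word l) →
                    IsLightClass (2 * t) l n m C → IsLightClass t (l * l) n m (encClass C)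
encode-lightClass {t} C ((len , acyclic , noShift) , noAntichain) =
  (len' , acyclic' , noShift') , λ anti → noAntichain (antichain-decode anti)
  where
  open Transfer {t} C len
  len' : ∀ i → length (encClass C i) ≡ t
  len' i = enc-length t (C i) (trans (len i) (2*≡double t))
  acyclic' : ∀ i → Acyclic (encClass C i)
  acyclic' i = enc-acyclic (even i) (acyclic i)
  noShift' : ∀ i i' → i ≢ i' → ¬ Σ ℕ (λ j → rot j (encClass C i) ≡ encClass C i')
  noShift' i i' i≢i' shift = noShift i i' i≢i' (enc-rot-reflect (even i) (even i') shift)

-- Lemma 5.4.1: ℶ(t, l², n) ≥ ℶ(2t, l, n).  (The pairing argument does not
-- use the standing assumption 2t < n.)
lemma5p4p1 : (t l n : ℕ) → 2 * t < n → BethGe t (l * l) n (2 * t) l n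
lemma5p4p1 t l n _ m (C , light) = m , NP.≤-refl , encClass C , encode-lightClass C light
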